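{- Let $a$ be a positive integer. The starlike tree $T(a,a+1,a+2)$ is transmission irregular if and only if $a$ is odd.
   Context: The transmission of a vertex $v$ of a graph $G$ is ${\rm Tr}_G(v)=\sum_{u\in V(G)} d_G(u,v)$; $G$ is transmission irregular if all its vertices have pairwise different transmissions. The starlike tree $T(k_1,k_2,k_3)$ is the tree obtained by attaching to a single vertex three pendant paths of lengths $k_1,k_2,k_3$. -}

module Defs where

open import Data.Nat using (ℕ; zero; suc; _+_; _≤_; _<_; _≟_; _<ᵇ_)
open import Data.Nat.Properties using ()
open import Data.Fin using (Fin; toℕ)
open import Data.Bool using (Bool; true; false; _∨_; _∧_; if_then_else_)
open import Data.List using (List; map; foldr)
open import Data.Nat.ListAction using (sum)
open import Relation.Nullary.Decidable using (⌊_⌋)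
open import Relation.Binary.PropositionalEquality using (_≡_; _≢_)
open import Data.Product using (Σ)

record Graph (n : ℕ) : Set where
  field
    adj     : Fin n → Fin n → Bool
    sym     : ∀ u v → adj u v ≡ adj v u
    irrefl  : ∀ u → adj u u ≡ false

open Graph public

vertices : (n : ℕ) → List (Fin n)
vertices n = Data.List.allFin n

reach : ∀ {n} → Graph n → ℕ → Fin n → Fin n → Bool
reach {n} G zero    u v = ⌊ toℕ u ≟ toℕ v ⌋
reach {n} G (suc k) u v =
  reach G k u v ∨ foldr (λ w b → (reach G k u w ∧ adj G w v) ∨ b) false (vertices n)

-- distance: least k with a walk of length k from u to v, searching
-- k = 0 .. bound; used for connected graphs with n vertices, where any
-- distance is < n, so searching up to n suffices (returns n otherwise).
distFrom : ∀ {n} → Graph n → ℕ → ℕ → Fin n → Fin n → ℕ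
distFrom G k zero     u v = k
distFrom G k (suc f)  u v = if reach G k u v then k else distFrom G (suc k) f u v

dist : ∀ {n} → Graph n → Fin n → Fin n → ℕ
dist {n} G u v = distFrom G 0 n u v

Connected : ∀ {n} → Graph n → Set
Connected {n} G = ∀ u v → reach G n u v ≡ true

Tr : ∀ {n} → Graph n → Fin n → ℕ
Tr {n} G v = sum (map (λ u → dist G u v) (vertices n))

TransmissionIrregular : ∀ {n} → Graph n → Set
TransmissionIrregular {n} G = ∀ u v → u ≢ v → Tr G u ≢ Tr G v

-- Starlike tree T(k₁,k₂,k₃): vertex 0 is the centre; vertices
-- 1..k₁ form the first pendant path (vertex i at distance i from the centre),
-- k₁+1..k₁+k₂ the second, k₁+k₂+1..k₁+k₂+k₃ the third.
-- parent m  = the neighbour of (non-centre) vertex m closer to the centre.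

parentℕ : ℕ → ℕ → ℕ → ℕ
parentℕ k₁ k₂ m =
  if (m ≡ᵇ 1) ∨ (m ≡ᵇ suc k₁) ∨ (m ≡ᵇ suc (k₁ + k₂)) then 0 else Data.Nat.pred m
  where open Data.Nat using (_≡ᵇ_)

starAdjℕ : ℕ → ℕ → ℕ → ℕ → Bool
starAdjℕ k₁ k₂ u v =
  ((0 <ᵇ u) ∧ (parentℕ k₁ k₂ u ≡ᵇ v)) ∨ ((0 <ᵇ v) ∧ (parentℕ k₁ k₂ v ≡ᵇ u))
  where open Data.Nat using (_≡ᵇ_)

private
  open Data.Nat using (_≡ᵇ_)
  open import Data.Bool.Properties using (∨-comm)
  open import Relation.Binary.PropositionalEquality using (refl)

  ≡ᵇ-pred : ∀ m → (m ≡ᵇ suc m) ≡ false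
  ≡ᵇ-pred zero = refl
  ≡ᵇ-pred (suc m) = ≡ᵇ-pred m

  zero≢suc : ∀ m → (0 ≡ᵇ suc m) ≡ false
  zero≢suc m = refl

  parent-irr : ∀ k₁ k₂ m → (parentℕ k₁ k₂ (suc m) ≡ᵇ suc m) ≡ false
  parent-irr k₁ k₂ m with (suc m ≡ᵇ 1) ∨ (suc m ≡ᵇ suc k₁) ∨ (suc m ≡ᵇ suc (k₁ + k₂))
  ... | true  = refl
  ... | false = ≡ᵇ-pred m

  starAdj-irr : ∀ k₁ k₂ u → starAdjℕ k₁ k₂ u u ≡ false
  starAdj-irr k₁ k₂ zero = refl
  starAdj-irr k₁ k₂ (suc m) rewrite parent-irr k₁ k₂ m = refl

T : (k₁ k₂ k₃ : ℕ) → Graph (suc (k₁ + k₂ + k₃))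
T k₁ k₂ k₃ = record
  { adj    = λ u v → starAdjℕ k₁ k₂ (toℕ u) (toℕ v)
  ; sym    = λ u v → ∨-comm ((0 <ᵇ toℕ u) ∧ (parentℕ k₁ k₂ (toℕ u) ≡ᵇ toℕ v)) ((0 <ᵇ toℕ v) ∧ (parentℕ k₁ k₂ (toℕ v) ≡ᵇ toℕ u))
  ; irrefl = λ u → starAdj-irr k₁ k₂ (toℕ u)
  }

Odd : ℕ → Set
Odd a = Σ ℕ (λ k → a ≡ suc (k + k))

module Submission where

-- In a starlike tree T(k₁,k₂,k₃) with K = k₁ + k₂ + k₃ non-central vertices,
-- the vertex at depth d on an arm of length L has transmission
--     Tr(v) = Tr(centre) + d·(d + K − 2L),
-- because moving d steps out along an arm adds d to the distance of every vertex off
-- that arm and changes distances along the arm by Σ|i − d| − Σ i.  For T(a, a+1, a+2)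
-- (so K = 3a + 3) the three arms give the quadratics d(d+a+3), d(d+a+1), d(d+a−1), which
-- differ only in the offset c of q_c(d) = d(d + c).  Each q_c is strictly increasing;
-- offsets differing by 2 never take a common value (q_{c+2}(d) lies strictly between
-- q_c(d) and q_c(d+1)), and offsets differing by 4 meet exactly when q_{c+4}(d) = q_c(d+1),
-- i.e. when c + 1 = 2d.  With c = a − 1 this happens iff a is even, giving a coincidence
-- between depth a/2 on the first arm and depth a/2 + 1 on the third.

open import Defs hiding (sym)
open import Data.Nat using (ℕ; zero; suc; pred; _+_; _*_; _∸_; _≡ᵇ_; _<ᵇ_; _<_; _≤_; z≤n; s≤s; z<s; s≤s⁻¹; _≤?_; ∣_-_∣)
open import Data.Nat.Properties
open import Data.Nat.Tactic.RingSolver using (solve-∀)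
open import Data.Nat.ListAction using (sum)
open import Data.Bool using (Bool; true; false; _∨_; _∧_; if_then_else_) renaming (T to IsTrue)
open import Data.Bool.Properties using (T-∨; T-∧)
open import Data.Fin using (Fin; toℕ; fromℕ<)
open import Data.Fin.Properties using (toℕ-injective; toℕ<n; toℕ-fromℕ<)
open import Data.List using ([]; _∷_; map; foldr; tabulate; allFin)
open import Data.List.Properties using (map-cong; map-tabulate)
open import Data.List.Membership.Propositional using (_∈_)
open import Data.List.Membership.Propositional.Properties using (∈-allFin)
open import Data.List.Relation.Unary.Any using (here; there)
open import Data.Product using (Σ; _×_; _,_; proj₁; proj₂)
open import Data.Sum using (_⊎_; inj₁; inj₂; [_,_]′) renaming (map to ⊎-map)
open import Data.Unit using (⊤; tt)
open import Data.Empty using (⊥-elim)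
open import Function.Base using (_∘_)
open import Function.Bundles using (_⇔_; mk⇔; Equivalence)
open import Relation.Nullary using (Dec; yes; no; does; ¬_)
open import Relation.Nullary.Decidable using (toWitness; fromWitness; dec-true; dec-false)
open import Relation.Binary.Definitions using (DecidableEquality; tri<; tri≈; tri>)
open import Relation.Binary.PropositionalEquality using (_≡_; _≢_; refl; sym; trans; cong; cong₂; subst; module ≡-Reasoning)

open Equivalence using (to; from)

S : (ℕ → ℕ) → ℕ → ℕ
S f zero    = 0
S f (suc n) = f 0 + S (λ i → f (suc i)) n

S-cong : ∀ {f g : ℕ → ℕ} n → (∀ i → i < n → f i ≡ g i) → S f n ≡ S g n
S-cong zero    f≡g = refl
S-cong (suc n) f≡g = cong₂ _+_ (f≡g 0 (s≤s z≤n)) (S-cong n (λ i i<n → f≡g (suc i) (s≤s i<n)))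

S-split : ∀ (f : ℕ → ℕ) m n → S f (m + n) ≡ S f m + S (λ i → f (m + i)) n
S-split f zero    n = refl
S-split f (suc m) n = trans (cong (f 0 +_) (S-split (λ i → f (suc i)) m n)) (sym (+-assoc (f 0) _ _))

S-shift : ∀ (f : ℕ → ℕ) c n → S (λ i → f i + c) n ≡ S f n + n * c
S-shift f c zero    = refl
S-shift f c (suc n) = begin
  f 0 + c + S (λ i → f (suc i) + c) n  ≡⟨ cong (f 0 + c +_) (S-shift (λ i → f (suc i)) c n) ⟩
  f 0 + c + (S (λ i → f (suc i)) n + n * c) ≡⟨ rearrange (f 0) c (S (λ i → f (suc i)) n) (n * c) ⟩
  f 0 + S (λ i → f (suc i)) n + (c + n * c)  ∎
  where
  open ≡-Reasoning
  rearrange : ∀ a b c d → a + b + (c + d) ≡ a + c + (b + d)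
  rearrange = solve-∀

-- The distances from the vertex at depth d on an arm of length L to the vertices of its
-- own arm: Σ_{i=1}^{L} |i − d| = Σ_{i=1}^{L} i + d² − d(L + 1), stated without subtraction.
-- Induction on d: moving one step out, the first term becomes d and the rest shift.
abs-sum : ∀ {d L} → d ≤ L → S (λ i → ∣ suc i - d ∣) L + d * suc L ≡ S suc L + d * d
abs-sum {zero}  {L}     _       = refl
abs-sum {suc d} {suc L} (s≤s h) = begin
  d + A + suc d * suc (suc L)             ≡⟨ split-off d A L ⟩
  A + d * suc L + (suc (d + d) + suc L)   ≡⟨ cong (_+ (suc (d + d) + suc L)) (abs-sum h) ⟩
  S suc L + d * d + (suc (d + d) + suc L) ≡⟨ collect d (S suc L) L ⟩
  suc (S suc L + L * 1) + suc d * suc d   ≡⟨ cong (λ t → suc t + suc d * suc d) (sym shifted) ⟩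
  suc (S (λ i → suc (suc i)) L) + suc d * suc d ∎
  where
  open ≡-Reasoning
  A : ℕ
  A = S (λ i → ∣ suc i - d ∣) L
  shifted : S (λ i → suc (suc i)) L ≡ S suc L + L * 1
  shifted = trans (S-cong L (λ i _ → +-comm 1 (suc i))) (S-shift suc 1 L)
  split-off : ∀ d A L → d + A + suc d * suc (suc L) ≡ A + d * suc L + (suc (d + d) + suc L)
  split-off = solve-∀
  collect : ∀ d Y L → Y + d * d + (suc (d + d) + suc L) ≡ suc (Y + L * 1) + suc d * suc d
  collect = solve-∀

-- How the three arm sums combine: if the own arm (length L) contributes X as above and the
-- two other arms (lengths m, n) each gain d per vertex, the total gains d(d + K) − 2dL.
arms-combine : ∀ {d L m n X X₀ Y Y₀ Z Z₀} →
  X + d * suc L ≡ X₀ + d * d → Y ≡ Y₀ + m * d → Z ≡ Z₀ + n * d →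
  d + (X + (Y + Z)) + 2 * (d * L) ≡ X₀ + (Y₀ + Z₀) + d * (d + (L + (m + n)))
arms-combine {d} {L} {m} {n} {X} {X₀} {_} {Y₀} {_} {Z₀} own refl refl = begin
  d + (X + (Y₀ + m * d + (Z₀ + n * d))) + 2 * (d * L) ≡⟨ regroup d L m n X Y₀ Z₀ ⟩
  X + d * suc L + (Y₀ + Z₀ + d * (L + (m + n)))       ≡⟨ cong (_+ (Y₀ + Z₀ + d * (L + (m + n)))) own ⟩
  X₀ + d * d + (Y₀ + Z₀ + d * (L + (m + n)))          ≡⟨ regroup₀ d L m n X₀ Y₀ Z₀ ⟩
  X₀ + (Y₀ + Z₀) + d * (d + (L + (m + n)))            ∎
  where
  open ≡-Reasoning
  regroup : ∀ d L m n X Y₀ Z₀ → d + (X + (Y₀ + m * d + (Z₀ + n * d))) + 2 * (d * L)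
                                ≡ X + d * suc L + (Y₀ + Z₀ + d * (L + (m + n)))
  regroup = solve-∀
  regroup₀ : ∀ d L m n X₀ Y₀ Z₀ → X₀ + d * d + (Y₀ + Z₀ + d * (L + (m + n)))
                                 ≡ X₀ + (Y₀ + Z₀) + d * (d + (L + (m + n)))
  regroup₀ = solve-∀

module _ {A : Set} (f : A → Bool) where

  search-sound : ∀ xs → IsTrue (foldr (λ w b → f w ∨ b) false xs) → Σ A (λ w → IsTrue (f w))
  search-sound []       ()
  search-sound (x ∷ xs) t = [ (x ,_) , search-sound xs ]′ (to T-∨ t)

  search-complete : ∀ {w} xs → w ∈ xs → IsTrue (f w) → IsTrue (foldr (λ w b → f w ∨ b) false xs)
  search-complete (x ∷ xs) (here refl) t = from T-∨ (inj₁ t)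
  search-complete (x ∷ xs) (there w∈xs) t = from T-∨ (inj₂ (search-complete xs w∈xs t))

if-true : ∀ {c} {A : Set} {x y : A} → IsTrue c → (if c then x else y) ≡ x
if-true {true} _ = refl

if-false : ∀ {c} {A : Set} {x y : A} → ¬ IsTrue c → (if c then x else y) ≡ y
if-false {false} _ = refl
if-false {true}  ¬t = ⊥-elim (¬t tt)

record IsGraphDistance {n : ℕ} (G : Graph n) (D : Fin n → Fin n → ℕ) : Set where
  field
    D-refl    : ∀ u → D u u ≡ 0
    D-zero    : ∀ u v → D u v ≡ 0 → u ≡ v
    D-edge    : ∀ u w v → IsTrue (adj G w v) → D u v ≤ suc (D u w)
    D-step    : ∀ u v k → D u v ≡ suc k → Σ (Fin n) (λ w → IsTrue (adj G w v) × D u w ≡ k)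
    D-bounded : ∀ u v → D u v < n

-- Any such D is the breadth-first distance of Defs: `reach G k u v` holds iff D u v ≤ k,
-- so the search in `distFrom` stops exactly at D u v.
module _ {n : ℕ} {G : Graph n} {D : Fin n → Fin n → ℕ} (isD : IsGraphDistance G D) where
  open IsGraphDistance isD

  reach-sound : ∀ k u v → IsTrue (reach G k u v) → D u v ≤ k
  reach-sound zero    u v t rewrite toℕ-injective (toWitness t) = ≤-reflexive (D-refl v)
  reach-sound (suc k) u v t = [ (λ r → m≤n⇒m≤1+n (reach-sound k u v r)) , viaNeighbour ]′ (to T-∨ t)
    where
    viaNeighbour : IsTrue (foldr (λ w b → (reach G k u w ∧ adj G w v) ∨ b) false (vertices n)) → D u v ≤ suc k
    viaNeighbour s with search-sound (λ w → reach G k u w ∧ adj G w v) (vertices n) s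
    ... | w , rw with to T-∧ rw
    ... | r , a = ≤-trans (D-edge u w v a) (s≤s (reach-sound k u w r))

  reach-complete : ∀ k u v → D u v ≤ k → IsTrue (reach G k u v)
  reach-complete zero    u v h = fromWitness (cong toℕ (D-zero u v (n≤0⇒n≡0 h)))
  reach-complete (suc k) u v h with D u v ≤? k
  ... | yes h′ = from T-∨ (inj₁ (reach-complete k u v h′))
  ... | no  h′ with D-step u v k (≤-antisym h (≰⇒> h′))
  ... | w , a , Dw = from T-∨ (inj₂ (search-complete (λ w → reach G k u w ∧ adj G w v) (vertices n)
                      (∈-allFin w) (from T-∧ (reach-complete k u w (≤-reflexive Dw) , a))))

  distFrom-correct : ∀ f k u v → k ≤ D u v → D u v < k + f → distFrom G k f u v ≡ D u v
  distFrom-correct zero    k u v k≤D D<k = ⊥-elim (<⇒≱ D<k (subst (_≤ D u v) (sym (+-identityʳ k)) k≤D))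
  distFrom-correct (suc f) k u v k≤D D<k with reach G k u v in eq
  ... | true  = ≤-antisym k≤D (reach-sound k u v (subst IsTrue (sym eq) tt))
  ... | false = distFrom-correct f (suc k) u v
                  (≰⇒> λ D≤k → subst IsTrue eq (reach-complete k u v D≤k))
                  (subst (D u v <_) (+-suc k f) D<k)

  dist-correct : ∀ u v → dist G u v ≡ D u v
  dist-correct u v = distFrom-correct n 0 u v z≤n (D-bounded u v)

sum-tabulate : ∀ n (f : ℕ → ℕ) → sum (tabulate {n = n} (λ i → f (toℕ i))) ≡ S f n
sum-tabulate zero    f = refl
sum-tabulate (suc n) f = cong (f 0 +_) (sum-tabulate n (λ i → f (suc i)))

Tr-as-sum : ∀ {n} (G : Graph n) (h : ℕ → Fin n → ℕ) → (∀ u v → dist G u v ≡ h (toℕ u) v) →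
            ∀ v → Tr G v ≡ S (λ m → h m v) n
Tr-as-sum {n} G h dist≡h v = begin
  sum (map (λ u → dist G u v) (allFin n))     ≡⟨ cong sum (map-cong (λ u → dist≡h u v) (allFin n)) ⟩
  sum (map (λ u → h (toℕ u) v) (allFin n))    ≡⟨ cong sum (map-tabulate {n = n} (λ i → i) (λ u → h (toℕ u) v)) ⟩
  sum (tabulate {n = n} (λ u → h (toℕ u) v))   ≡⟨ sum-tabulate n (λ m → h m v) ⟩
  S (λ m → h m v) n                            ∎
  where open ≡-Reasoning

data Branch : Set where
  b₁ b₂ b₃ : Branch

_≟ᴮ_ : DecidableEquality Branch
b₁ ≟ᴮ b₁ = yes refl
b₂ ≟ᴮ b₂ = yes refl
b₃ ≟ᴮ b₃ = yes refl
b₁ ≟ᴮ b₂ = no λ ()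
b₁ ≟ᴮ b₃ = no λ ()
b₂ ≟ᴮ b₁ = no λ ()
b₂ ≟ᴮ b₃ = no λ ()
b₃ ≟ᴮ b₁ = no λ ()
b₃ ≟ᴮ b₂ = no λ ()

data Pos : Set where
  ctr : Pos
  on  : Branch → ℕ → Pos

Valid : (Branch → ℕ) → Pos → Set
Valid len ctr      = ⊤
Valid len (on b d) = 0 < d × d ≤ len b

Dp : Pos → Pos → ℕ
Dp ctr      ctr      = 0
Dp ctr      (on _ e) = e
Dp (on _ d) ctr      = d
Dp (on b d) (on c e) = if does (b ≟ᴮ c) then ∣ d - e ∣ else d + e

Dp-same : ∀ b d e → Dp (on b d) (on b e) ≡ ∣ d - e ∣
Dp-same b d e rewrite dec-true (b ≟ᴮ b) refl = refl

Dp-diff : ∀ {b c} → b ≢ c → ∀ d e → Dp (on b d) (on c e) ≡ d + e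
Dp-diff {b} {c} b≢c d e rewrite dec-false (b ≟ᴮ c) b≢c = refl

Dp-refl : ∀ p → Dp p p ≡ 0
Dp-refl ctr      = refl
Dp-refl (on b d) = trans (Dp-same b d d) (∣n-n∣≡0 d)

Dp-zero : ∀ {len} p q → Valid len p → Valid len q → Dp p q ≡ 0 → p ≡ q
Dp-zero ctr            ctr            _        _        _ = refl
Dp-zero (on b zero)    _              (() , _) _        _
Dp-zero _              (on c zero)    _        (() , _) _
Dp-zero ctr            (on c (suc e)) _        _        ()
Dp-zero (on b (suc d)) ctr            _        _        ()
Dp-zero (on b (suc d)) (on c e)       _        _        Dp≡0 = by-branch (b ≟ᴮ c)
  where
  by-branch : Dec (b ≡ c) → on b (suc d) ≡ on c e
  by-branch (yes refl) = cong (on b) (∣m-n∣≡0⇒m≡n (trans (sym (Dp-same b (suc d) e)) Dp≡0))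
  by-branch (no b≢c) with () ← trans (sym (Dp-diff b≢c (suc d) e)) Dp≡0

at : Branch → ℕ → Pos
at b zero    = ctr
at b (suc d) = on b (suc d)

data Edge : Pos → Pos → Set where
  edge : ∀ b e → Edge (on b (suc e)) (at b e)

Adjacent : Pos → Pos → Set
Adjacent p q = Edge p q ⊎ Edge q p

at-valid : ∀ {len} b e → Valid len (on b (suc e)) → Valid len (at b e)
at-valid b zero    _            = tt
at-valid b (suc e) (_ , e<len) = s≤s z≤n , <⇒≤ e<len

Dp-at : ∀ x b e → Dp x (at b e) ≡ Dp x (on b e)
Dp-at x        b (suc e) = refl
Dp-at ctr      b zero    = refl
Dp-at (on c d) b zero    = by-branch (c ≟ᴮ b)
  where
  by-branch : Dec (c ≡ b) → d ≡ Dp (on c d) (on b 0)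
  by-branch (yes refl) = sym (trans (Dp-same c d 0) (∣-∣-identityʳ d))
  by-branch (no c≢b)   = sym (trans (Dp-diff c≢b d 0) (+-identityʳ d))

abs-up : ∀ m n → m ≤ n → suc ∣ m - n ∣ ≡ ∣ m - suc n ∣
abs-up zero    n       _       = refl
abs-up (suc m) (suc n) (s≤s h) = abs-up m n h

abs-down : ∀ m n → n < m → suc ∣ m - suc n ∣ ≡ ∣ m - n ∣
abs-down (suc m) zero    _       = cong suc (∣-∣-identityʳ m)
abs-down (suc m) (suc n) (s≤s h) = abs-down m n h

Dp-arm-step : ∀ x b e → Dp x (on b (suc e)) ≡ suc (Dp x (on b e))
                      ⊎ suc (Dp x (on b (suc e))) ≡ Dp x (on b e)
Dp-arm-step ctr      b e = inj₁ refl
Dp-arm-step (on c d) b e = by-branch (c ≟ᴮ b)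
  where
  by-branch : Dec (c ≡ b) → Dp (on c d) (on b (suc e)) ≡ suc (Dp (on c d) (on b e))
                          ⊎ suc (Dp (on c d) (on b (suc e))) ≡ Dp (on c d) (on b e)
  by-branch (no c≢b) rewrite Dp-diff c≢b d (suc e) | Dp-diff c≢b d e = inj₁ (+-suc d e)
  by-branch (yes refl) rewrite Dp-same c d (suc e) | Dp-same c d e with d ≤? e
  ... | yes d≤e = inj₁ (sym (abs-up d e d≤e))
  ... | no  d≰e = inj₂ (abs-down d e (≰⇒> d≰e))

edge-close : ∀ x {p q} → Edge p q → Dp x p ≤ suc (Dp x q) × Dp x q ≤ suc (Dp x p)
edge-close x (edge b e) rewrite Dp-at x b e with Dp-arm-step x b e
... | inj₁ up   = ≤-reflexive up , m≤n⇒m≤1+n (≤-trans (n≤1+n _) (≤-reflexive (sym up)))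
... | inj₂ down = m≤n⇒m≤1+n (≤-trans (n≤1+n _) (≤-reflexive down)) , ≤-reflexive (sym down)

adjacent-close : ∀ x {w v} → Adjacent w v → Dp x v ≤ suc (Dp x w)
adjacent-close x (inj₁ w→v) = proj₂ (edge-close x w→v)
adjacent-close x (inj₂ v→w) = proj₁ (edge-close x v→w)

-- From any valid x ≠ q there is a valid neighbour w of q one step closer to x: the
-- neighbour towards the centre, unless x lies further out on the arm of q.
towards : ∀ {len} x q → Valid len x → Valid len q → x ≢ q →
          Σ Pos (λ w → Valid len w × Adjacent w q × suc (Dp x w) ≡ Dp x q)
towards ctr            ctr            _        _        x≢q = ⊥-elim (x≢q refl)
towards _              (on c zero)    _        (() , _) _
towards (on b zero)    _              (() , _) _        _
towards ctr            (on c (suc e)) _        vq       _   =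
  at c e , at-valid c e vq , inj₂ (edge c e) , cong suc (Dp-at ctr c e)
towards (on b (suc d)) ctr            (_ , d<len) _     _   =
  on b 1 , (s≤s z≤n , ≤-trans (s≤s z≤n) d<len) , inj₁ (edge b 0) ,
  cong suc (trans (Dp-same b (suc d) 1) (∣-∣-identityʳ d))
towards {len} (on b (suc d)) (on c (suc e)) vx vq x≢q = by-branch (b ≟ᴮ c)
  where
  x q : Pos
  x = on b (suc d)
  q = on c (suc e)
  by-branch : Dec (b ≡ c) → Σ Pos (λ w → Valid len w × Adjacent w q × suc (Dp x w) ≡ Dp x q)
  by-branch (no b≢c) = at c e , at-valid c e vq , inj₂ (edge c e) ,
    trans (cong suc (trans (Dp-at x c e) (Dp-diff b≢c (suc d) e)))
          (trans (sym (+-suc (suc d) e)) (sym (Dp-diff b≢c (suc d) (suc e))))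
  by-branch (yes refl) with <-cmp d e
  ... | tri≈ _ refl _ = ⊥-elim (x≢q refl)
  ... | tri< d<e _ _ = at b e , at-valid b e vq , inj₂ (edge b e) ,
    trans (cong suc (trans (Dp-at x b e) (Dp-same b (suc d) e)))
          (trans (abs-up (suc d) e d<e) (sym (Dp-same b (suc d) (suc e))))
  ... | tri> _ _ e<d =
    on b (suc (suc e)) , (s≤s z≤n , ≤-trans (s≤s e<d) (proj₂ vx)) , inj₁ (edge b (suc e)) ,
    trans (cong suc (Dp-same b (suc d) (suc (suc e))))
          (trans (abs-down d e e<d) (sym (Dp-same b (suc d) (suc e))))

other₁ other₂ : Branch → Branch
other₁ b₁ = b₂
other₁ b₂ = b₁
other₁ b₃ = b₁
other₂ b₁ = b₃
other₂ b₂ = b₃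
other₂ b₃ = b₂

other₁≢ : ∀ b → other₁ b ≢ b
other₁≢ b₁ ()
other₁≢ b₂ ()
other₁≢ b₃ ()

other₂≢ : ∀ b → other₂ b ≢ b
other₂≢ b₁ ()
other₂≢ b₂ ()
other₂≢ b₃ ()

other-arm : ∀ b c → b ≢ c → c ≡ other₁ b ⊎ c ≡ other₂ b
other-arm b₁ b₁ b≢c = ⊥-elim (b≢c refl)
other-arm b₂ b₂ b≢c = ⊥-elim (b≢c refl)
other-arm b₃ b₃ b≢c = ⊥-elim (b≢c refl)
other-arm b₁ b₂ _   = inj₁ refl
other-arm b₁ b₃ _   = inj₂ refl
other-arm b₂ b₁ _   = inj₁ refl
other-arm b₂ b₃ _   = inj₂ refl
other-arm b₃ b₁ _   = inj₁ refl
other-arm b₃ b₂ _   = inj₂ refl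

over-arms : (Branch → ℕ) → ℕ
over-arms f = f b₁ + (f b₂ + f b₃)

over-arms-focus : ∀ f b → over-arms f ≡ f b + (f (other₁ b) + f (other₂ b))
over-arms-focus f b₁ = refl
over-arms-focus f b₂ = bring-middle (f b₁) (f b₂) (f b₃)
  where
  bring-middle : ∀ x y z → x + (y + z) ≡ y + (x + z)
  bring-middle = solve-∀
over-arms-focus f b₃ = bring-last (f b₁) (f b₂) (f b₃)
  where
  bring-last : ∀ x y z → x + (y + z) ≡ z + (x + y)
  bring-last = solve-∀

module Starlike (p₁ p₂ p₃ : ℕ) where

  k₁ k₂ k₃ K N : ℕ
  k₁ = suc p₁
  k₂ = suc p₂
  k₃ = suc p₃
  K  = k₁ + k₂ + k₃
  N  = suc K

  G : Graph N
  G = T k₁ k₂ k₃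

  len : Branch → ℕ
  len b₁ = k₁
  len b₂ = k₂
  len b₃ = k₃

  K-arms : ∀ b → K ≡ len b + (len (other₁ b) + len (other₂ b))
  K-arms b = trans (+-assoc k₁ k₂ k₃) (over-arms-focus len b)

  len≤K : ∀ b → len b ≤ K
  len≤K b = subst (len b ≤_) (sym (K-arms b)) (m≤m+n (len b) _)

  len-pair : ∀ b c → b ≢ c → len b + len c ≤ K
  len-pair b c b≢c =
    subst (len b + len c ≤_) (sym (K-arms b)) (+-monoʳ-≤ (len b) (other-len (other-arm b c b≢c)))
    where
    other-len : c ≡ other₁ b ⊎ c ≡ other₂ b → len c ≤ len (other₁ b) + len (other₂ b)
    other-len (inj₁ refl) = m≤m+n _ _
    other-len (inj₂ refl) = m≤n+m _ _

  Dp-bound : ∀ p q → Valid len p → Valid len q → Dp p q ≤ K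
  Dp-bound ctr      ctr      _            _            = z≤n
  Dp-bound ctr      (on c e) _            (_ , e≤len) = ≤-trans e≤len (len≤K c)
  Dp-bound (on b d) ctr      (_ , d≤len) _            = ≤-trans d≤len (len≤K b)
  Dp-bound (on b d) (on c e) (_ , d≤len) (_ , e≤len) = by-branch (b ≟ᴮ c)
    where
    by-branch : Dec (b ≡ c) → Dp (on b d) (on c e) ≤ K
    by-branch (yes refl) = subst (_≤ K) (sym (Dp-same b d e))
      (≤-trans (∣m-n∣≤m⊔n d e) (⊔-lub (≤-trans d≤len (len≤K b)) (≤-trans e≤len (len≤K b))))
    by-branch (no b≢c)   = subst (_≤ K) (sym (Dp-diff b≢c d e))
      (≤-trans (+-mono-≤ d≤len e≤len) (len-pair b c b≢c))

  -- The vertex number of a position, as in Defs.  Arm offsets are added on the right so that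
  -- the first vertices 1, suc k₁, suc (k₁ + k₂) of the arms are the literal terms tested by `parentℕ`.
  enc : Pos → ℕ
  enc ctr       = 0
  enc (on b₁ d) = d
  enc (on b₂ d) = d + k₁
  enc (on b₃ d) = d + (k₁ + k₂)

  enc<N : ∀ p → Valid len p → enc p < N
  enc<N ctr       _            = s≤s z≤n
  enc<N (on b₁ d) (_ , d≤len) = s≤s (≤-trans d≤len (len≤K b₁))
  enc<N (on b₂ d) (_ , d≤len) = s≤s (≤-trans (+-monoˡ-≤ k₁ d≤len) (subst (_≤ K) (+-comm k₁ k₂) (m≤m+n _ k₃)))
  enc<N (on b₃ d) (_ , d≤len) = s≤s (≤-trans (+-monoˡ-≤ (k₁ + k₂) d≤len) (≤-reflexive (+-comm k₃ (k₁ + k₂))))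

  pos : ℕ → Pos
  pos zero = ctr
  pos (suc m) with suc m ≤? k₁
  ... | yes _ = on b₁ (suc m)
  ... | no  _ with suc m ≤? k₁ + k₂
  ...   | yes _ = on b₂ (suc m ∸ k₁)
  ...   | no  _ = on b₃ (suc m ∸ (k₁ + k₂))

  pos-correct : ∀ m → m < N → Valid len (pos m) × enc (pos m) ≡ m
  pos-correct zero    _   = tt , refl
  pos-correct (suc m) m<N with suc m ≤? k₁
  ... | yes m≤k₁ = (s≤s z≤n , m≤k₁) , refl
  ... | no  m≰k₁ with suc m ≤? k₁ + k₂
  ...   | yes m≤k₁₂ =
    (m<n⇒0<n∸m (≰⇒> m≰k₁) , m≤n+o⇒m∸n≤o (suc m) k₁ m≤k₁₂) , m∸n+n≡m (<⇒≤ (≰⇒> m≰k₁))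
  ...   | no  m≰k₁₂ =
    (m<n⇒0<n∸m (≰⇒> m≰k₁₂) , m≤n+o⇒m∸n≤o (suc m) (k₁ + k₂) (s≤s⁻¹ m<N)) , m∸n+n≡m (<⇒≤ (≰⇒> m≰k₁₂))

  pos-enc : ∀ p → Valid len p → pos (enc p) ≡ p
  pos-enc ctr _ = refl
  pos-enc (on b zero) (() , _)
  pos-enc (on b₁ (suc d)) (_ , d≤len) with suc d ≤? k₁
  ... | yes _   = refl
  ... | no  d≰k = ⊥-elim (d≰k d≤len)
  pos-enc (on b₂ (suc d)) (_ , d≤len) with suc (d + k₁) ≤? k₁
  ... | yes past = ⊥-elim (<⇒≱ (m<n+m k₁ z<s) past)
  ... | no  _ with suc (d + k₁) ≤? k₁ + k₂
  ...   | yes _    = cong (on b₂) (m+n∸n≡m (suc d) k₁)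
  ...   | no  d≰k = ⊥-elim (d≰k (subst (suc d + k₁ ≤_) (+-comm k₂ k₁) (+-monoˡ-≤ k₁ d≤len)))
  pos-enc (on b₃ (suc d)) (_ , d≤len) with suc (d + (k₁ + k₂)) ≤? k₁
  ... | yes past = ⊥-elim (<⇒≱ (≤-<-trans (m≤m+n k₁ k₂) (m<n+m (k₁ + k₂) z<s)) past)
  ... | no  _ with suc (d + (k₁ + k₂)) ≤? k₁ + k₂
  ...   | yes past = ⊥-elim (<⇒≱ (m<n+m (k₁ + k₂) z<s) past)
  ...   | no  _    = cong (on b₃) (m+n∸n≡m (suc d) (k₁ + k₂))

  enc-injective : ∀ {p q} → Valid len p → Valid len q → enc p ≡ enc q → p ≡ q
  enc-injective {p} {q} vp vq e = trans (sym (pos-enc p vp)) (trans (cong pos e) (pos-enc q vq))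

  P : Fin N → Pos
  P u = pos (toℕ u)

  P-valid : ∀ u → Valid len (P u)
  P-valid u = proj₁ (pos-correct (toℕ u) (toℕ<n u))

  enc-P : ∀ u → enc (P u) ≡ toℕ u
  enc-P u = proj₂ (pos-correct (toℕ u) (toℕ<n u))

  P-injective : ∀ {u v} → P u ≡ P v → u ≡ v
  P-injective {u} {v} e = toℕ-injective (trans (sym (enc-P u)) (trans (cong enc e) (enc-P v)))

  vertex : (p : Pos) → Valid len p → Fin N
  vertex p vp = fromℕ< (enc<N p vp)

  P-vertex : ∀ p vp → P (vertex p vp) ≡ p
  P-vertex p vp = trans (cong pos (toℕ-fromℕ< (enc<N p vp))) (pos-enc p vp)

  isStart : ℕ → Bool
  isStart m = (m ≡ᵇ 1) ∨ (m ≡ᵇ suc k₁) ∨ (m ≡ᵇ suc (k₁ + k₂))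

  start : ∀ b → IsTrue (isStart (enc (on b 1)))
  start b₁ = tt
  start b₂ = from (T-∨ {suc k₁ ≡ᵇ suc k₁}) (inj₁ (≡⇒≡ᵇ (suc k₁) _ refl))
  start b₃ = from (T-∨ {suc (k₁ + k₂) ≡ᵇ suc k₁}) (inj₂ (≡⇒≡ᵇ (suc (k₁ + k₂)) _ refl))

  not-start : ∀ b d → Valid len (on b (suc (suc d))) → ¬ IsTrue (isStart (enc (on b (suc (suc d)))))
  not-start b d v t = [ is-first b₁ , [ is-first b₂ , is-first b₃ ]′ ∘ to T-∨ ]′ (to T-∨ t)
    where
    first-valid : ∀ c → Valid len (on c 1)
    first-valid b₁ = s≤s z≤n , s≤s z≤n
    first-valid b₂ = s≤s z≤n , s≤s z≤n
    first-valid b₃ = s≤s z≤n , s≤s z≤n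
    is-first : ∀ c → ¬ IsTrue (enc (on b (suc (suc d))) ≡ᵇ enc (on c 1))
    is-first c t with () ← enc-injective v (first-valid c) (≡ᵇ⇒≡ _ _ t)

  pred-enc : ∀ b d → pred (enc (on b (suc (suc d)))) ≡ enc (on b (suc d))
  pred-enc b₁ d = refl
  pred-enc b₂ d = refl
  pred-enc b₃ d = refl

  parent-enc : ∀ b e → Valid len (on b (suc e)) → parentℕ k₁ k₂ (enc (on b (suc e))) ≡ enc (at b e)
  parent-enc b zero    _ = if-true (start b)
  parent-enc b (suc d) v = trans (if-false (not-start b d v)) (pred-enc b d)

  enc-positive : ∀ b e → 0 < enc (on b (suc e))
  enc-positive b₁ e = z<s
  enc-positive b₂ e = z<s
  enc-positive b₃ e = z<s

  childᵇ : ℕ → ℕ → Bool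
  childᵇ m n = (0 <ᵇ m) ∧ (parentℕ k₁ k₂ m ≡ᵇ n)

  half-sound : ∀ p q → Valid len p → Valid len q → IsTrue (childᵇ (enc p) (enc q)) → Edge p q
  half-sound ctr            q _        _  ()
  half-sound (on b zero)    q (() , _) _ _
  half-sound (on b (suc e)) q vp       vq t = subst (Edge (on b (suc e))) parent≡q (edge b e)
    where
    parent≡q : at b e ≡ q
    parent≡q = enc-injective (at-valid b e vp) vq
                 (trans (sym (parent-enc b e vp)) (≡ᵇ⇒≡ _ _ (proj₂ (to T-∧ t))))

  half-complete : ∀ {p q} → Valid len p → Edge p q → IsTrue (childᵇ (enc p) (enc q))
  half-complete vp (edge b e) = from T-∧ (<⇒<ᵇ (enc-positive b e) , ≡⇒≡ᵇ _ _ (parent-enc b e vp))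

  adj-enc : ∀ u v → adj G u v ≡ (childᵇ (enc (P u)) (enc (P v)) ∨ childᵇ (enc (P v)) (enc (P u)))
  adj-enc u v = cong₂ (λ m n → childᵇ m n ∨ childᵇ n m) (sym (enc-P u)) (sym (enc-P v))

  adj-sound : ∀ w v → IsTrue (adj G w v) → Adjacent (P w) (P v)
  adj-sound w v t = ⊎-map (half-sound _ _ (P-valid w) (P-valid v)) (half-sound _ _ (P-valid v) (P-valid w))
                      (to T-∨ (subst IsTrue (adj-enc w v) t))

  adj-complete : ∀ w v → Adjacent (P w) (P v) → IsTrue (adj G w v)
  adj-complete w v a = subst IsTrue (sym (adj-enc w v))
                         (from T-∨ (⊎-map (half-complete (P-valid w)) (half-complete (P-valid v)) a))

  D : Fin N → Fin N → ℕ
  D u v = Dp (P u) (P v)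

  D-isGraphDistance : IsGraphDistance G D
  D-isGraphDistance = record
    { D-refl    = λ u → Dp-refl (P u)
    ; D-zero    = λ u v e → P-injective (Dp-zero (P u) (P v) (P-valid u) (P-valid v) e)
    ; D-edge    = λ u w v a → adjacent-close (P u) (adj-sound w v a)
    ; D-step    = step
    ; D-bounded = λ u v → s≤s (Dp-bound (P u) (P v) (P-valid u) (P-valid v))
    }
    where
    step : ∀ u v k → D u v ≡ suc k → Σ (Fin N) (λ w → IsTrue (adj G w v) × D u w ≡ k)
    step u v k Duv≡1+k with towards (P u) (P v) (P-valid u) (P-valid v) distinct
      where
      distinct : P u ≢ P v
      distinct Pu≡Pv = 0≢1+n (trans (sym (trans (cong (λ x → Dp x (P v)) Pu≡Pv) (Dp-refl (P v)))) Duv≡1+k)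
    ... | w , vw , w~v , closer =
      vertex w vw ,
      adj-complete (vertex w vw) v (subst (λ x → Adjacent x (P v)) (sym (P-vertex w vw)) w~v) ,
      trans (cong (Dp (P u)) (P-vertex w vw)) (suc-injective (trans closer Duv≡1+k))

  arm : (Pos → ℕ) → Branch → ℕ
  arm h b = S (λ i → h (on b (suc i))) (len b)

  sum-positions : ∀ (h : Pos → ℕ) → S (λ m → h (pos m)) N ≡ h ctr + over-arms (arm h)
  sum-positions h = cong (h ctr +_) (begin
    S g (k₁ + k₂ + k₃)                                                  ≡⟨ S-split g (k₁ + k₂) k₃ ⟩
    S g (k₁ + k₂) + S (λ i → g (k₁ + k₂ + i)) k₃                        ≡⟨ cong (_+ S (λ i → g (k₁ + k₂ + i)) k₃) (S-split g k₁ k₂) ⟩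
    S g k₁ + S (λ i → g (k₁ + i)) k₂ + S (λ i → g (k₁ + k₂ + i)) k₃    ≡⟨ +-assoc (S g k₁) _ _ ⟩
    S g k₁ + (S (λ i → g (k₁ + i)) k₂ + S (λ i → g (k₁ + k₂ + i)) k₃)  ≡⟨ cong₂ _+_ (block b₁ 0 (λ _ → refl))
                                                                              (cong₂ _+_ (block b₂ k₁ (λ i → cong suc (+-comm i k₁)))
                                                                                         (block b₃ (k₁ + k₂) (λ i → cong suc (+-comm i (k₁ + k₂))))) ⟩
    over-arms (arm h)                                                   ∎)
    where
    open ≡-Reasoning
    g : ℕ → ℕ
    g i = h (pos (suc i))
    block : ∀ b o → (∀ i → enc (on b (suc i)) ≡ suc (o + i)) → S (λ i → g (o + i)) (len b) ≡ arm h b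
    block b o enc≡ = S-cong (len b) λ i i<len →
      cong h (trans (cong pos (sym (enc≡ i))) (pos-enc (on b (suc i)) (s≤s z≤n , i<len)))

  armDist : Pos → Branch → ℕ
  armDist q = arm (λ p → Dp p q)

  transmission : Pos → ℕ
  transmission q = Dp ctr q + over-arms (armDist q)

  Tr-pos : ∀ v → Tr G v ≡ transmission (P v)
  Tr-pos v = trans (Tr-as-sum G (λ m v → Dp (pos m) (P v)) (dist-correct D-isGraphDistance) v)
                   (sum-positions (λ p → Dp p (P v)))

  arm-other : ∀ {b c} → c ≢ b → ∀ d → armDist (on b d) c ≡ S suc (len c) + len c * d
  arm-other {b} {c} c≢b d = trans (S-cong (len c) (λ i _ → Dp-diff c≢b (suc i) d)) (S-shift suc d (len c))

  arm-own : ∀ b d → d ≤ len b → armDist (on b d) b + d * suc (len b) ≡ S suc (len b) + d * d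
  arm-own b d d≤len =
    trans (cong (_+ d * suc (len b)) (S-cong (len b) (λ i _ → Dp-same b (suc i) d))) (abs-sum d≤len)

  transmission-arm : ∀ b d → d ≤ len b →
                     transmission (on b d) + 2 * (d * len b) ≡ transmission ctr + d * (d + K)
  transmission-arm b d d≤len = begin
    d + over-arms A + 2 * (d * len b)
      ≡⟨ cong (λ t → d + t + 2 * (d * len b)) (over-arms-focus A b) ⟩
    d + (A b + (A (other₁ b) + A (other₂ b))) + 2 * (d * len b)
      ≡⟨ arms-combine {d} {len b} {len (other₁ b)} {len (other₂ b)}
           (arm-own b d d≤len) (arm-other (other₁≢ b) d) (arm-other (other₂≢ b) d) ⟩
    A₀ b + (A₀ (other₁ b) + A₀ (other₂ b)) + d * (d + (len b + (len (other₁ b) + len (other₂ b))))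
      ≡⟨ sym (cong₂ (λ s t → s + d * (d + t)) (over-arms-focus A₀ b) (K-arms b)) ⟩
    over-arms A₀ + d * (d + K) ∎
    where
    open ≡-Reasoning
    A A₀ : Branch → ℕ
    A  = armDist (on b d)
    A₀ = armDist ctr

quad : ℕ → ℕ → ℕ
quad c d = d * (d + c)

quad-mono-≤ : ∀ c {d e} → d ≤ e → quad c d ≤ quad c e
quad-mono-≤ c d≤e = *-mono-≤ d≤e (+-monoˡ-≤ c d≤e)

quad-mono-< : ∀ c {d e} → d < e → quad c d < quad c e
quad-mono-< c d<e = *-mono-< d<e (+-monoˡ-< c d<e)

quad-reflect : ∀ c {d e} → quad c d < quad c e → d < e
quad-reflect c lt = ≰⇒> λ e≤d → <⇒≱ lt (quad-mono-≤ c e≤d)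

quad-injective : ∀ c {d e} → quad c d ≡ quad c e → d ≡ e
quad-injective c eq = ≤-antisym (≮⇒≥ λ e<d → <⇒≢ (quad-mono-< c e<d) (sym eq))
                                (≮⇒≥ λ d<e → <⇒≢ (quad-mono-< c d<e) eq)

-- Offsets two apart never meet: q_{c+2}(d+1) lies strictly between q_c(d+1) and q_c(d+2).
quad-gap₂ : ∀ c d e → quad (c + 2) (suc d) ≢ quad c e
quad-gap₂ c d e eq = <⇒≱ (quad-reflect c {suc d} {e} below) (s≤s⁻¹ (quad-reflect c {e} above))
  where
  widen : ∀ c d → d * (d + (c + 2)) ≡ d * (d + c) + 2 * d
  widen = solve-∀
  next : ∀ c d → suc d * (suc d + c) ≡ d * (d + (c + 2)) + suc c
  next = solve-∀
  below : quad c (suc d) < quad c e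
  below = subst (quad c (suc d) <_) eq (subst (quad c (suc d) <_) (sym (widen c (suc d))) (m<m+n _ z<s))
  above : quad c e < quad c (suc (suc d))
  above = subst (_< quad c (suc (suc d))) eq (subst (quad (c + 2) (suc d) <_) (sym (next c (suc d))) (m<m+n _ z<s))

-- Offsets four apart: q_{c+4}(d) + (c + 1) = q_c(d + 1) + 2d, and q_{c+4}(d+1) lies strictly
-- between q_c(d+1) and q_c(d+3); so q_{c+4}(d+1) = q_c(e) forces e = d + 2 and c + 1 = 2(d + 1),
-- and conversely c + 1 = 2d gives q_{c+4}(d) = q_c(d + 1).
quad-shift : ∀ c d → d * (d + ((c + 2) + 2)) + suc c ≡ suc d * (suc d + c) + (d + d)
quad-shift = solve-∀

quad-gap₄ : ∀ c d e → quad ((c + 2) + 2) (suc d) ≡ quad c e → suc c ≡ suc d + suc d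
quad-gap₄ c d e eq = +-cancelˡ-≡ (quad c e) _ _ (begin
  quad c e + suc c                            ≡⟨ cong (_+ suc c) (sym eq) ⟩
  quad ((c + 2) + 2) (suc d) + suc c          ≡⟨ quad-shift c (suc d) ⟩
  quad c (suc (suc d)) + (suc d + suc d)      ≡⟨ cong (λ t → quad c t + (suc d + suc d)) (sym e≡2+d) ⟩
  quad c e + (suc d + suc d)                  ∎)
  where
  open ≡-Reasoning
  widen : ∀ c d → d * (d + ((c + 2) + 2)) ≡ d * (d + c) + 4 * d
  widen = solve-∀
  next : ∀ c d → suc (suc d) * (suc (suc d) + c) ≡ d * (d + ((c + 2) + 2)) + suc (suc (suc (suc (c + c))))
  next = solve-∀
  below : quad c (suc d) < quad c e
  below = subst (quad c (suc d) <_) eq (subst (quad c (suc d) <_) (sym (widen c (suc d))) (m<m+n _ z<s))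
  above : quad c e < quad c (suc (suc (suc d)))
  above = subst (_< quad c (suc (suc (suc d)))) eq
            (subst (quad ((c + 2) + 2) (suc d) <_) (sym (next c (suc d))) (m<m+n _ z<s))
  e≡2+d : e ≡ suc (suc d)
  e≡2+d = ≤-antisym (s≤s⁻¹ (quad-reflect c {e} above)) (quad-reflect c {suc d} below)

quad-collision : ∀ c d → suc c ≡ d + d → quad ((c + 2) + 2) d ≡ quad c (suc d)
quad-collision c d c+1≡2d =
  +-cancelʳ-≡ (suc c) _ _ (trans (quad-shift c d) (cong (quad c (suc d) +_) (sym c+1≡2d)))

odd-or-even : ∀ n → Odd n ⊎ Σ ℕ (λ m → n ≡ m + m)
odd-or-even zero    = inj₂ (0 , refl)
odd-or-even (suc n) with odd-or-even n
... | inj₁ (k , n≡1+2k) = inj₂ (suc k , cong suc (trans n≡1+2k (sym (+-suc k k))))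
... | inj₂ (m , n≡2m)   = inj₁ (m , cong suc n≡2m)

odd≢even : ∀ k m → suc (k + k) ≢ m + m
odd≢even zero    (suc m) eq = 0≢1+n (trans (suc-injective eq) (+-suc m m))
odd≢even (suc k) (suc m) eq =
  odd≢even k m (suc-injective (trans (cong suc (sym (+-suc k k))) (trans (suc-injective eq) (+-suc m m))))

-- The tree T(a, a+1, a+2) with a = suc x.  The arm offsets K − 2·len are a + 3, a + 1, a − 1,
-- and every transmission is Tr(centre) plus the excess q_{offset}(depth).
module Consecutive (x : ℕ) where
  open Starlike x (x + 1) (x + 2)

  offset : Branch → ℕ
  offset b₁ = (x + 2) + 2
  offset b₂ = x + 2
  offset b₃ = x

  offset-balance : ∀ b → offset b + 2 * len b ≡ K
  offset-balance b₁ = balance₁ x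
    where
    balance₁ : ∀ x → (x + 2) + 2 + 2 * suc x ≡ suc x + suc (x + 1) + suc (x + 2)
    balance₁ = solve-∀
  offset-balance b₂ = balance₂ x
    where
    balance₂ : ∀ x → x + 2 + 2 * suc (x + 1) ≡ suc x + suc (x + 1) + suc (x + 2)
    balance₂ = solve-∀
  offset-balance b₃ = balance₃ x
    where
    balance₃ : ∀ x → x + 2 * suc (x + 2) ≡ suc x + suc (x + 1) + suc (x + 2)
    balance₃ = solve-∀

  excess : Pos → ℕ
  excess ctr      = 0
  excess (on b d) = quad (offset b) d

  Tr-excess : ∀ v → Tr G v ≡ transmission ctr + excess (P v)
  Tr-excess v = trans (Tr-pos v) (by-position (P v) (P-valid v))
    where
    expand : ∀ t d c L → t + d * (d + (c + 2 * L)) ≡ t + d * (d + c) + 2 * (d * L)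
    expand = solve-∀
    by-position : ∀ q → Valid len q → transmission q ≡ transmission ctr + excess q
    by-position ctr      _            = sym (+-identityʳ _)
    by-position (on b d) (_ , d≤len) = +-cancelʳ-≡ (2 * (d * len b)) _ _ (begin
      transmission (on b d) + 2 * (d * len b)
        ≡⟨ transmission-arm b d d≤len ⟩
      transmission ctr + d * (d + K)
        ≡⟨ cong (λ k → transmission ctr + d * (d + k)) (sym (offset-balance b)) ⟩
      transmission ctr + d * (d + (offset b + 2 * len b))
        ≡⟨ expand (transmission ctr) d (offset b) (len b) ⟩
      transmission ctr + quad (offset b) d + 2 * (d * len b) ∎)
      where open ≡-Reasoning

  -- For odd a the excess is injective on valid positions: arms with offsets two apart never
  -- meet (`quad-gap₂`), and arms 1 and 3 would force a to be even (`quad-gap₄`).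
  excess-injective : Odd (suc x) → ∀ p q → Valid len p → Valid len q → excess p ≡ excess q → p ≡ q
  excess-injective _   ctr            ctr            _        _        _  = refl
  excess-injective _   (on b zero)    _              (() , _) _        _
  excess-injective _   _              (on c zero)    _        (() , _) _
  excess-injective _   ctr            (on c (suc e)) _        _        ()
  excess-injective _   (on b (suc d)) ctr            _        _        ()
  excess-injective (k , a≡1+2k) (on b (suc d)) (on c (suc e)) _ _ eq = by-branch (b ≟ᴮ c)
    where
    across : ∀ b c → quad (offset b) (suc d) ≡ quad (offset c) (suc e) → b ≡ c
    across b₁ b₁ _  = refl
    across b₂ b₂ _  = refl
    across b₃ b₃ _  = refl
    across b₁ b₂ eq = ⊥-elim (quad-gap₂ (x + 2) d (suc e) eq)
    across b₂ b₁ eq = ⊥-elim (quad-gap₂ (x + 2) e (suc d) (sym eq))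
    across b₂ b₃ eq = ⊥-elim (quad-gap₂ x d (suc e) eq)
    across b₃ b₂ eq = ⊥-elim (quad-gap₂ x e (suc d) (sym eq))
    across b₁ b₃ eq = ⊥-elim (odd≢even k (suc d) (trans (sym a≡1+2k) (quad-gap₄ x d (suc e) eq)))
    across b₃ b₁ eq = ⊥-elim (odd≢even k (suc e) (trans (sym a≡1+2k) (quad-gap₄ x e (suc d) (sym eq))))
    by-branch : Dec (b ≡ c) → on b (suc d) ≡ on c (suc e)
    by-branch (yes refl) = cong (on b) (quad-injective (offset b) eq)
    by-branch (no b≢c)   = ⊥-elim (b≢c (across b c eq))

  odd⇒irregular : Odd (suc x) → TransmissionIrregular G
  odd⇒irregular odd u v u≢v Tru≡Trv =
    u≢v (P-injective (excess-injective odd (P u) (P v) (P-valid u) (P-valid v) excess≡))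
    where
    excess≡ : excess (P u) ≡ excess (P v)
    excess≡ = +-cancelˡ-≡ (transmission ctr) _ _
                (trans (sym (Tr-excess u)) (trans Tru≡Trv (Tr-excess v)))

  even⇒regular : Σ ℕ (λ m → suc x ≡ m + m) → ¬ TransmissionIrregular G
  even⇒regular (zero  , ())
  even⇒regular (suc m , a≡2m) irregular = irregular (vertex p vp) (vertex q vq) distinct equal
    where
    p q : Pos
    p = on b₁ (suc m)
    q = on b₃ (suc (suc m))
    m≤a : suc m ≤ suc x
    m≤a = subst (suc m ≤_) (sym a≡2m) (m≤m+n (suc m) (suc m))
    vp : Valid len p
    vp = s≤s z≤n , m≤a
    vq : Valid len q
    vq = s≤s z≤n , s≤s (≤-trans m≤a (≤-trans (n≤1+n (suc x)) (≤-reflexive (+-comm 2 x))))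
    distinct : vertex p vp ≢ vertex q vq
    distinct e with () ← trans (sym (P-vertex p vp)) (trans (cong P e) (P-vertex q vq))
    equal : Tr G (vertex p vp) ≡ Tr G (vertex q vq)
    equal = begin
      Tr G (vertex p vp)                           ≡⟨ Tr-excess (vertex p vp) ⟩
      transmission ctr + excess (P (vertex p vp))  ≡⟨ cong (λ r → transmission ctr + excess r) (P-vertex p vp) ⟩
      transmission ctr + excess p                  ≡⟨ cong (transmission ctr +_) (quad-collision x (suc m) a≡2m) ⟩
      transmission ctr + excess q                  ≡⟨ cong (λ r → transmission ctr + excess r) (sym (P-vertex q vq)) ⟩
      transmission ctr + excess (P (vertex q vq))  ≡⟨ sym (Tr-excess (vertex q vq)) ⟩
      Tr G (vertex q vq)                           ∎
      where open ≡-Reasoning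

corollary2p4 : (a : ℕ) → 0 < a → (TransmissionIrregular (T a (a + 1) (a + 2)) ⇔ Odd a)
corollary2p4 zero    ()
corollary2p4 (suc x) _ = mk⇔ irregular⇒odd odd⇒irregular
  where
  open Consecutive x
  irregular⇒odd : TransmissionIrregular (T (suc x) (suc x + 1) (suc x + 2)) → Odd (suc x)
  irregular⇒odd irregular =
    [ (λ odd → odd) , (λ even → ⊥-elim (even⇒regular even irregular)) ]′ (odd-or-even (suc x))
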